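{- Let $\Gamma,\Delta$ be finite sets of formulas. The following are equivalent: (i) the sequent $\Gamma\Rightarrow\Delta$ is provable in the sequent calculus $\mathfrak{Lt}$; (ii) $\Gamma\Rightarrow\Delta$ is valid; (iii) $\Gamma\models^{\le}_{\mathbf{tDL}}\Delta$.
   Context: Formulas are built from a countably infinite set of variables and constants $\top,\bot$ using binary $\wedge,\vee$ and unary $\mathbf{G},\mathbf{H},\mathbf{F},\mathbf{P}$. A $\mathbf{tDL}$-algebra is a bounded distributive lattice $\langle A,\wedge,\vee,0,1\rangle$ with unary operators $\mathbf{G},\mathbf{H},\mathbf{F},\mathbf{P}$ satisfying for all $x,y$: $\mathbf{G}1=\mathbf{H}1=1$; $\mathbf{G},\mathbf{H}$ preserve $\wedge$; $x\le\mathbf{G}\mathbf{P}x$, $x\le\mathbf{H}\mathbf{F}x$; $\mathbf{G}(x\vee y)\le\mathbf{G}x\vee\mathbf{F}y$, $\mathbf{H}(x\vee y)\le\mathbf{H}x\vee\mathbf{P}y$; $\mathbf{F}0=\mathbf{P}0=0$; $\mathbf{F},\mathbf{P}$ preserve $\vee$; $\mathbf{P}\mathbf{G}x\le x$, $\mathbf{F}\mathbf{H}x\le x$; $\mathbf{G}x\wedge\mathbf{F}y\le\mathbf{F}(x\wedge y)$, $\mathbf{H}x\wedge\mathbf{P}y\le\mathbf{P}(x\wedge y)$. A sequent $\Gamma\Rightarrow\Delta$ is valid (equivalently $\Gamma\models^{\le}_{\mathbf{tDL}}\Delta$) iff for every $\mathbf{tDL}$-algebra $A$ and every homomorphism $h$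 from the formula algebra to $A$ (interpreting $\top,\bot$ as $1,0$), $\bigwedge\{h(\gamma):\gamma\in\Gamma\}\le\bigvee\{h(\delta):\delta\in\Delta\}$ (empty meet $=1$, empty join $=0$). $\mathfrak{Lt}$ has axioms $\alpha\Rightarrow\alpha$, $\bot\Rightarrow$, $\Rightarrow\top$ and rules (premises / conclusion; $\#\Gamma=\{\#\gamma:\gamma\in\Gamma\}$): weakening $\Gamma\Rightarrow\Delta/\Gamma,\alpha\Rightarrow\Delta$ and $\Gamma\Rightarrow\Delta/\Gamma\Rightarrow\Delta,\alpha$; cut $\Gamma\Rightarrow\Delta,\alpha$ and $\alpha,\Gamma\Rightarrow\Delta$ / $\Gamma\Rightarrow\Delta$; $\Gamma,\alpha,\beta\Rightarrow\Delta/\Gamma,\alpha\wedge\beta\Rightarrow\Delta$; $\Gamma\Rightarrow\Delta,\alpha$ and $\Gamma\Rightarrow\Delta,\beta$ / $\Gamma\Rightarrow\Delta,\alpha\wedge\beta$; $\Gamma,\alpha\Rightarrow\Delta$ and $\Gamma,\beta\Rightarrow\Delta$ / $\Gamma,\alpha\vee\beta\Rightarrow\Delta$; $\Gamma\Rightarrow\Delta,\alpha,\beta/\Gamma\Rightarrow\Delta,\alpha\vee\beta$; $\Gamma\Rightarrow\Delta,\alpha/\mathbf{G}\Gamma\Rightarrow\mathbf{F}\Delta,\mathbf{G}\alpha$; $\Gamma\Rightarrow\Delta,\alpha/\mathbf{H}\Gamma\Rightarrow\mathbf{P}\Delta,\mathbf{H}\alpha$; $\Gamma,\alpha\Rightarrow\Delta/\mathbf{G}\Gamma,\mathbf{F}\alpha\Rightarrow\mathbf{F}\Delta$;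 $\Gamma,\alpha\Rightarrow\Delta/\mathbf{H}\Gamma,\mathbf{P}\alpha\Rightarrow\mathbf{P}\Delta$; $\alpha\Rightarrow\Delta/\mathbf{P}\mathbf{G}\alpha\Rightarrow\Delta$; $\alpha\Rightarrow\Delta/\mathbf{F}\mathbf{H}\alpha\Rightarrow\Delta$; $\Gamma\Rightarrow\alpha/\Gamma\Rightarrow\mathbf{G}\mathbf{P}\alpha$; $\Gamma\Rightarrow\alpha/\Gamma\Rightarrow\mathbf{H}\mathbf{F}\alpha$. Here $\Gamma,\Delta$ are finite sets of formulas. -}

module Defs where

open import Level using (Level; _⊔_; suc)
open import Data.Nat using (ℕ)
open import Data.List using (List; []; _∷_; map)
open import Algebra.Core using (Op₁; Op₂)
open import Algebra.Lattice.Structures using (IsDistributiveLattice)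
open import Data.List.Relation.Binary.Subset.Propositional using (_⊆_)
open import Relation.Binary.Core using (Rel)

infixr 6 _`∧_
infixr 5 _`∨_

data Formula : Set where
  var      : ℕ → Formula
  `⊤ `⊥    : Formula
  _`∧_ _`∨_ : Formula → Formula → Formula
  `G `H `F `P : Formula → Formula

record TDLAlgebra (c ℓ : Level) : Set (suc (c ⊔ ℓ)) where
  infixr 6 _∧_
  infixr 5 _∨_
  infix 4 _≈_ _≤_
  field
    Carrier : Set c
    _≈_     : Rel Carrier ℓ
    _∧_ _∨_ : Op₂ Carrier
    0# 1#   : Carrier
    G H F P : Op₁ Carrier
    isDistributiveLattice : IsDistributiveLattice _≈_ _∨_ _∧_
    ∨-identityʳ : ∀ x → (x ∨ 0#) ≈ x
    ∧-identityʳ : ∀ x → (x ∧ 1#) ≈ x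
    G-cong : ∀ {x y} → x ≈ y → G x ≈ G y
    H-cong : ∀ {x y} → x ≈ y → H x ≈ H y
    F-cong : ∀ {x y} → x ≈ y → F x ≈ F y
    P-cong : ∀ {x y} → x ≈ y → P x ≈ P y

  _≤_ : Carrier → Carrier → Set ℓ
  x ≤ y = (x ∧ y) ≈ x

  field
    G-1    : G 1# ≈ 1#
    H-1    : H 1# ≈ 1#
    G-∧    : ∀ x y → G (x ∧ y) ≈ (G x ∧ G y)
    H-∧    : ∀ x y → H (x ∧ y) ≈ (H x ∧ H y)
    GP-unit : ∀ x → x ≤ G (P x)
    HF-unit : ∀ x → x ≤ H (F x)
    G-∨    : ∀ x y → G (x ∨ y) ≤ (G x ∨ F y)
    H-∨    : ∀ x y → H (x ∨ y) ≤ (H x ∨ P y)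
    F-0    : F 0# ≈ 0#
    P-0    : P 0# ≈ 0#
    F-∨    : ∀ x y → F (x ∨ y) ≈ (F x ∨ F y)
    P-∨    : ∀ x y → P (x ∨ y) ≈ (P x ∨ P y)
    PG-counit : ∀ x → P (G x) ≤ x
    FH-counit : ∀ x → F (H x) ≤ x
    G-F    : ∀ x y → (G x ∧ F y) ≤ F (x ∧ y)
    H-P    : ∀ x y → (H x ∧ P y) ≤ P (x ∧ y)

  ⋀ : List Carrier → Carrier
  ⋀ []       = 1#
  ⋀ (x ∷ xs) = x ∧ ⋀ xs

  ⋁ : List Carrier → Carrier
  ⋁ []       = 0#
  ⋁ (x ∷ xs) = x ∨ ⋁ xs

record Hom {c ℓ} (A : TDLAlgebra c ℓ) : Set (c ⊔ ℓ) where
  open TDLAlgebra A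
  field
    h     : Formula → Carrier
    h-⊤   : h `⊤ ≈ 1#
    h-⊥   : h `⊥ ≈ 0#
    h-∧   : ∀ α β → h (α `∧ β) ≈ (h α ∧ h β)
    h-∨   : ∀ α β → h (α `∨ β) ≈ (h α ∨ h β)
    h-G   : ∀ α → h (`G α) ≈ G (h α)
    h-H   : ∀ α → h (`H α) ≈ H (h α)
    h-F   : ∀ α → h (`F α) ≈ F (h α)
    h-P   : ∀ α → h (`P α) ≈ P (h α)

-- Finite sets of formulas are represented by lists; the rule `set-eq`
-- identifies sequents whose antecedents/succedents have the same elements,
-- so that lists behave as finite sets.  "Γ,α" is written α ∷ Γ.

Cedent : Set
Cedent = List Formula

infix 3 _⇒_

data _⇒_ : Cedent → Cedent → Set where
  set-eq : ∀ {Γ Γ' Δ Δ'} → Γ ⊆ Γ' → Γ' ⊆ Γ → Δ ⊆ Δ' → Δ' ⊆ Δ →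
           Γ ⇒ Δ → Γ' ⇒ Δ'
  ax   : ∀ {α} → (α ∷ []) ⇒ (α ∷ [])
  ⊥-ax : (`⊥ ∷ []) ⇒ []
  ⊤-ax : [] ⇒ (`⊤ ∷ [])
  wL : ∀ {Γ Δ α} → Γ ⇒ Δ → (α ∷ Γ) ⇒ Δ
  wR : ∀ {Γ Δ α} → Γ ⇒ Δ → Γ ⇒ (α ∷ Δ)
  cut : ∀ {Γ Δ α} → Γ ⇒ (α ∷ Δ) → (α ∷ Γ) ⇒ Δ → Γ ⇒ Δ
  ∧L : ∀ {Γ Δ α β} → (α ∷ β ∷ Γ) ⇒ Δ → ((α `∧ β) ∷ Γ) ⇒ Δ
  ∧R : ∀ {Γ Δ α β} → Γ ⇒ (α ∷ Δ) → Γ ⇒ (β ∷ Δ) → Γ ⇒ ((α `∧ β) ∷ Δ)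
  ∨L : ∀ {Γ Δ α β} → (α ∷ Γ) ⇒ Δ → (β ∷ Γ) ⇒ Δ → ((α `∨ β) ∷ Γ) ⇒ Δ
  ∨R : ∀ {Γ Δ α β} → Γ ⇒ (α ∷ β ∷ Δ) → Γ ⇒ ((α `∨ β) ∷ Δ)
  GR : ∀ {Γ Δ α} → Γ ⇒ (α ∷ Δ) → map `G Γ ⇒ (`G α ∷ map `F Δ)
  HR : ∀ {Γ Δ α} → Γ ⇒ (α ∷ Δ) → map `H Γ ⇒ (`H α ∷ map `P Δ)
  FL : ∀ {Γ Δ α} → (α ∷ Γ) ⇒ Δ → (`F α ∷ map `G Γ) ⇒ map `F Δ
  PL : ∀ {Γ Δ α} → (α ∷ Γ) ⇒ Δ → (`P α ∷ map `H Γ) ⇒ map `P Δ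
  PGL : ∀ {Δ α} → (α ∷ []) ⇒ Δ → (`P (`G α) ∷ []) ⇒ Δ
  FHL : ∀ {Δ α} → (α ∷ []) ⇒ Δ → (`F (`H α) ∷ []) ⇒ Δ
  GPR : ∀ {Γ α} → Γ ⇒ (α ∷ []) → Γ ⇒ (`G (`P α) ∷ [])
  HFR : ∀ {Γ α} → Γ ⇒ (α ∷ []) → Γ ⇒ (`H (`F α) ∷ [])

Valid : (c ℓ : Level) → Cedent → Cedent → Set (suc (c ⊔ ℓ))
Valid c ℓ Γ Δ = (A : TDLAlgebra c ℓ) (φ : Hom A) →
  let open TDLAlgebra A ; open Hom φ in ⋀ (map h Γ) ≤ ⋁ (map h Δ)

_⊨≤[_,_]_ : Cedent → (c ℓ : Level) → Cedent → Set (suc (c ⊔ ℓ))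
Γ ⊨≤[ c , ℓ ] Δ = (A : TDLAlgebra c ℓ) (φ : Hom A) →
  let open TDLAlgebra A ; open Hom φ in ⋀ (map h Γ) ≤ ⋁ (map h Δ)

-- Soundness: each rule of 𝔏t is an inequality valid in every tDL-algebra,
-- the temporal rules being exactly the tDL axioms read through monotonicity
-- and distributivity. Completeness: formulas modulo interderivability form a
-- tDL-algebra (the Lindenbaum–Tarski algebra), because the rules of 𝔏t derive
-- its axioms; under the canonical valuation α ↦ [α], validity of Γ ⇒ Δ gives
-- ⋀Γ ⊢ ⋁Δ, and Γ ⇒ Δ follows by cutting with Γ ⇒ ⋀Γ and ⋁Δ ⇒ Δ.

{-# OPTIONS --safe #-}
module Submission where

open import Level using (Level; Lift; lift; lower)
open import Data.List using (List; []; _∷_; map; _++_)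
open import Data.List.Membership.Propositional using (_∈_)
open import Data.List.Membership.Propositional.Properties using (∈-++⁻)
open import Data.List.Relation.Binary.Subset.Propositional using (_⊆_)
open import Data.List.Relation.Binary.Subset.Propositional.Properties
  using (xs⊆xs++ys; ∈-∷⁺ʳ; map⁺)
open import Data.List.Relation.Unary.Any using (here; there)
open import Data.Product using (_×_; _,_; proj₂)
open import Data.Sum using ([_,_]′)
open import Function.Base using (id; _∘_)
open import Function.Bundles using (_⇔_; mk⇔)
open import Relation.Binary.PropositionalEquality using (refl)
import Algebra.Lattice.Bundles as Alg
import Algebra.Lattice.Properties.Lattice as AlgLatticeProperties
import Algebra.Lattice.Structures as AlgStructures
import Relation.Binary.Lattice as Ord
import Relation.Binary.Lattice.Properties.Lattice as OrdLatticeProperties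
import Relation.Binary.Lattice.Properties.DistributiveLattice as OrdDistributiveLatticeProperties
import Relation.Binary.Reasoning.PartialOrder as ≤-Reasoning
open import Defs

pattern #0 = here refl
pattern #1 = there #0

weakenL* : ∀ {Γ Δ} Θ → Γ ⇒ Δ → Θ ++ Γ ⇒ Δ
weakenL* []      p = p
weakenL* (_ ∷ Θ) p = wL (weakenL* Θ p)

weakenR* : ∀ {Γ Δ} Θ → Γ ⇒ Δ → Γ ⇒ Θ ++ Δ
weakenR* []      p = p
weakenR* (_ ∷ Θ) p = wR (weakenR* Θ p)

++-absorbs-⊆ : ∀ {A : Set} {xs ys : List A} → xs ⊆ ys → ys ++ xs ⊆ ys
++-absorbs-⊆ {ys = ys} xs⊆ys = [ id , xs⊆ys ]′ ∘ ∈-++⁻ ys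

weaken : ∀ {Γ Δ Γ′ Δ′} → Γ ⊆ Γ′ → Δ ⊆ Δ′ → Γ ⇒ Δ → Γ′ ⇒ Δ′
weaken {Γ} {Δ} {Γ′} {Δ′} Γ⊆Γ′ Δ⊆Δ′ p =
  set-eq (++-absorbs-⊆ Γ⊆Γ′) (xs⊆xs++ys Γ′ Γ) (++-absorbs-⊆ Δ⊆Δ′) (xs⊆xs++ys Δ′ Δ)
         (weakenR* Δ′ (weakenL* Γ′ p))

[_]⊆ : ∀ {α : Formula} {Γ} → α ∈ Γ → α ∷ [] ⊆ Γ
[ α∈Γ ]⊆ = ∈-∷⁺ʳ α∈Γ (λ ())

swap⊆ : ∀ {α β : Formula} {Γ} → α ∷ β ∷ Γ ⊆ β ∷ α ∷ Γ
swap⊆ (here eq)         = there (here eq)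
swap⊆ (there (here eq)) = here eq
swap⊆ (there (there p)) = there (there p)

init : ∀ {α Γ Δ} → α ∈ Γ → α ∈ Δ → Γ ⇒ Δ
init α∈Γ α∈Δ = weaken [ α∈Γ ]⊆ [ α∈Δ ]⊆ ax

cut-single : ∀ {Γ Δ α} → Γ ⇒ α ∷ [] → α ∷ [] ⇒ Δ → Γ ⇒ Δ
cut-single p q = cut (weaken id [ #0 ]⊆ p) (weaken [ #0 ]⊆ id q)

-- Soundness

module DistributiveLatticeOrder {c ℓ} (L : Alg.DistributiveLattice c ℓ) where
  open Alg.DistributiveLattice L
  open Ord.Lattice (AlgLatticeProperties.∨-∧-orderTheoreticLattice lattice) public
    using (poset; x≤x∨y; y≤x∨y; ∨-least; x∧y≤x; x∧y≤y; ∧-greatest; antisym)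
    renaming (_≤_ to _⊑_; refl to ⊑-refl; trans to ⊑-trans; reflexive to ⊑-reflexive)
  open ≤-Reasoning poset

  cut-⊑ : ∀ {x a d} → x ⊑ a ∨ d → a ∧ x ⊑ d → x ⊑ d
  cut-⊑ {x} {a} {d} x⊑a∨d a∧x⊑d = begin
    x                  ≤⟨ ∧-greatest ⊑-refl x⊑a∨d ⟩
    x ∧ (a ∨ d)        ≈⟨ ∧-distribˡ-∨ x a d ⟩
    (x ∧ a) ∨ (x ∧ d)  ≤⟨ ∨-least (⊑-trans (⊑-reflexive (∧-comm x a)) a∧x⊑d) (x∧y≤y x d) ⟩
    d                  ∎

  ∧-greatest-∨ʳ : ∀ {x a b d} → x ⊑ a ∨ d → x ⊑ b ∨ d → x ⊑ (a ∧ b) ∨ d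
  ∧-greatest-∨ʳ {x} {a} {b} {d} x⊑a∨d x⊑b∨d = begin
    x                  ≤⟨ ∧-greatest x⊑a∨d x⊑b∨d ⟩
    (a ∨ d) ∧ (b ∨ d)  ≈⟨ sym (∨-distribʳ-∧ d a b) ⟩
    (a ∧ b) ∨ d        ∎

  ∨-least-∧ʳ : ∀ {x a b d} → a ∧ x ⊑ d → b ∧ x ⊑ d → (a ∨ b) ∧ x ⊑ d
  ∨-least-∧ʳ {x} {a} {b} {d} a∧x⊑d b∧x⊑d = begin
    (a ∨ b) ∧ x        ≈⟨ ∧-distribʳ-∨ x a b ⟩
    (a ∧ x) ∨ (b ∧ x)  ≤⟨ ∨-least a∧x⊑d b∧x⊑d ⟩
    d                  ∎

module TDLAlgebraProperties {c ℓ} (A : TDLAlgebra c ℓ) where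
  open TDLAlgebra A
  open AlgStructures.IsDistributiveLattice isDistributiveLattice
    using (sym; ∧-comm)
    renaming (trans to ≈-trans)

  distributiveLattice : Alg.DistributiveLattice c ℓ
  distributiveLattice = record { isDistributiveLattice = isDistributiveLattice }

  open DistributiveLatticeOrder distributiveLattice public
  open ≤-Reasoning poset

  -- The order of the tDL axioms is x ∧ y ≈ x, the library's is x ≈ x ∧ y.
  ≤⇒⊑ : ∀ {x y} → x ≤ y → x ⊑ y
  ≤⇒⊑ = sym

  ⊑⇒≤ : ∀ {x y} → x ⊑ y → x ≤ y
  ⊑⇒≤ = sym

  1-greatest : ∀ x → x ⊑ 1#
  1-greatest x = sym (∧-identityʳ x)

  0-least : ∀ x → 0# ⊑ x
  0-least x = ⊑-trans (y≤x∨y x 0#) (⊑-reflexive (∨-identityʳ x))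

  ⊑⇒∨≈ : ∀ {x y} → x ⊑ y → x ∨ y ≈ y
  ⊑⇒∨≈ x⊑y = antisym (∨-least x⊑y ⊑-refl) (y≤x∨y _ _)

  G-mono : ∀ {x y} → x ⊑ y → G x ⊑ G y
  G-mono {x} {y} x⊑y = ≈-trans (G-cong x⊑y) (G-∧ x y)

  H-mono : ∀ {x y} → x ⊑ y → H x ⊑ H y
  H-mono {x} {y} x⊑y = ≈-trans (H-cong x⊑y) (H-∧ x y)

  F-mono : ∀ {x y} → x ⊑ y → F x ⊑ F y
  F-mono {x} {y} x⊑y =
    ⊑-trans (x≤x∨y _ _) (⊑-reflexive (≈-trans (sym (F-∨ x y)) (F-cong (⊑⇒∨≈ x⊑y))))

  P-mono : ∀ {x y} → x ⊑ y → P x ⊑ P y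
  P-mono {x} {y} x⊑y =
    ⊑-trans (x≤x∨y _ _) (⊑-reflexive (≈-trans (sym (P-∨ x y)) (P-cong (⊑⇒∨≈ x⊑y))))

  G-rule : ∀ {x a d} → x ⊑ a ∨ d → G x ⊑ G a ∨ F d
  G-rule x⊑a∨d = ⊑-trans (G-mono x⊑a∨d) (≤⇒⊑ (G-∨ _ _))

  H-rule : ∀ {x a d} → x ⊑ a ∨ d → H x ⊑ H a ∨ P d
  H-rule x⊑a∨d = ⊑-trans (H-mono x⊑a∨d) (≤⇒⊑ (H-∨ _ _))

  F-rule : ∀ {x a d} → a ∧ x ⊑ d → F a ∧ G x ⊑ F d
  F-rule {x} {a} {d} a∧x⊑d = begin
    F a ∧ G x  ≈⟨ ∧-comm (F a) (G x) ⟩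
    G x ∧ F a  ≤⟨ ≤⇒⊑ (G-F x a) ⟩
    F (x ∧ a)  ≤⟨ F-mono (⊑-trans (⊑-reflexive (∧-comm x a)) a∧x⊑d) ⟩
    F d        ∎

  P-rule : ∀ {x a d} → a ∧ x ⊑ d → P a ∧ H x ⊑ P d
  P-rule {x} {a} {d} a∧x⊑d = begin
    P a ∧ H x  ≈⟨ ∧-comm (P a) (H x) ⟩
    H x ∧ P a  ≤⟨ ≤⇒⊑ (H-P x a) ⟩
    P (x ∧ a)  ≤⟨ P-mono (⊑-trans (⊑-reflexive (∧-comm x a)) a∧x⊑d) ⟩
    P d        ∎

  ⋀-lower : ∀ {x xs} → x ∈ xs → ⋀ xs ⊑ x
  ⋀-lower #0 = x∧y≤x _ _
  ⋀-lower (there x∈xs) = ⊑-trans (x∧y≤y _ _) (⋀-lower x∈xs)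

  ⋁-upper : ∀ {x xs} → x ∈ xs → x ⊑ ⋁ xs
  ⋁-upper #0 = x≤x∨y _ _
  ⋁-upper (there x∈xs) = ⊑-trans (⋁-upper x∈xs) (y≤x∨y _ _)

  ⋀-antitone : ∀ {xs ys} → xs ⊆ ys → ⋀ ys ⊑ ⋀ xs
  ⋀-antitone {[]}     _     = 1-greatest _
  ⋀-antitone {_ ∷ _} xs⊆ys = ∧-greatest (⋀-lower (xs⊆ys #0)) (⋀-antitone (xs⊆ys ∘ there))

  ⋁-monotone : ∀ {xs ys} → xs ⊆ ys → ⋁ xs ⊑ ⋁ ys
  ⋁-monotone {[]}     _     = 0-least _
  ⋁-monotone {_ ∷ _} xs⊆ys = ∨-least (⋁-upper (xs⊆ys #0)) (⋁-monotone (xs⊆ys ∘ there))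

module Soundness {c ℓ} (A : TDLAlgebra c ℓ) (φ : Hom A) where
  open TDLAlgebra A
  open Hom φ
  open AlgStructures.IsDistributiveLattice isDistributiveLattice
    using (sym; ∧-cong; ∨-cong; ∧-assoc; ∨-assoc)
    renaming (refl to ≈-refl; trans to ≈-trans)
  open TDLAlgebraProperties A
  open ≤-Reasoning poset

  ⋀-map-G : ∀ Γ → ⋀ (map h (map `G Γ)) ≈ G (⋀ (map h Γ))
  ⋀-map-G []      = sym G-1
  ⋀-map-G (α ∷ Γ) = ≈-trans (∧-cong (h-G α) (⋀-map-G Γ)) (sym (G-∧ _ _))

  ⋀-map-H : ∀ Γ → ⋀ (map h (map `H Γ)) ≈ H (⋀ (map h Γ))
  ⋀-map-H []      = sym H-1
  ⋀-map-H (α ∷ Γ) = ≈-trans (∧-cong (h-H α) (⋀-map-H Γ)) (sym (H-∧ _ _))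

  ⋁-map-F : ∀ Δ → ⋁ (map h (map `F Δ)) ≈ F (⋁ (map h Δ))
  ⋁-map-F []      = sym F-0
  ⋁-map-F (α ∷ Δ) = ≈-trans (∨-cong (h-F α) (⋁-map-F Δ)) (sym (F-∨ _ _))

  ⋁-map-P : ∀ Δ → ⋁ (map h (map `P Δ)) ≈ P (⋁ (map h Δ))
  ⋁-map-P []      = sym P-0
  ⋁-map-P (α ∷ Δ) = ≈-trans (∨-cong (h-P α) (⋁-map-P Δ)) (sym (P-∨ _ _))

  sound : ∀ {Γ Δ} → Γ ⇒ Δ → ⋀ (map h Γ) ⊑ ⋁ (map h Δ)
  sound (set-eq Γ⊆Γ′ _ Δ⊆Δ′ _ p) =
    ⊑-trans (⋀-antitone (map⁺ h Γ⊆Γ′)) (⊑-trans (sound p) (⋁-monotone (map⁺ h Δ⊆Δ′)))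
  sound ax      = ⊑-trans (x∧y≤x _ _) (x≤x∨y _ _)
  sound ⊥-ax    = ⊑-trans (x∧y≤x _ _) (⊑-reflexive h-⊥)
  sound ⊤-ax    = ⊑-trans (⊑-reflexive (sym h-⊤)) (x≤x∨y _ _)
  sound (wL p)  = ⊑-trans (x∧y≤y _ _) (sound p)
  sound (wR p)  = ⊑-trans (sound p) (y≤x∨y _ _)
  sound (cut p q) = cut-⊑ (sound p) (sound q)
  sound (∧L {α = α} {β} p) =
    ⊑-trans (⊑-reflexive (≈-trans (∧-cong (h-∧ α β) ≈-refl) (∧-assoc _ _ _))) (sound p)
  sound (∧R {α = α} {β} p q) =
    ⊑-trans (∧-greatest-∨ʳ (sound p) (sound q)) (⊑-reflexive (∨-cong (sym (h-∧ α β)) ≈-refl))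
  sound (∨L {α = α} {β} p q) =
    ⊑-trans (⊑-reflexive (∧-cong (h-∨ α β) ≈-refl)) (∨-least-∧ʳ (sound p) (sound q))
  sound (∨R {α = α} {β} p) =
    ⊑-trans (sound p) (⊑-reflexive (≈-trans (sym (∨-assoc _ _ _)) (∨-cong (sym (h-∨ α β)) ≈-refl)))
  sound (GR {Γ} {Δ} {α} p) = begin
    ⋀ (map h (map `G Γ))             ≈⟨ ⋀-map-G Γ ⟩
    G (⋀ (map h Γ))                  ≤⟨ G-rule (sound p) ⟩
    G (h α) ∨ F (⋁ (map h Δ))        ≈⟨ ∨-cong (sym (h-G α)) (sym (⋁-map-F Δ)) ⟩
    h (`G α) ∨ ⋁ (map h (map `F Δ))  ∎
  sound (HR {Γ} {Δ} {α} p) = begin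
    ⋀ (map h (map `H Γ))             ≈⟨ ⋀-map-H Γ ⟩
    H (⋀ (map h Γ))                  ≤⟨ H-rule (sound p) ⟩
    H (h α) ∨ P (⋁ (map h Δ))        ≈⟨ ∨-cong (sym (h-H α)) (sym (⋁-map-P Δ)) ⟩
    h (`H α) ∨ ⋁ (map h (map `P Δ))  ∎
  sound (FL {Γ} {Δ} {α} p) = begin
    h (`F α) ∧ ⋀ (map h (map `G Γ))  ≈⟨ ∧-cong (h-F α) (⋀-map-G Γ) ⟩
    F (h α) ∧ G (⋀ (map h Γ))        ≤⟨ F-rule (sound p) ⟩
    F (⋁ (map h Δ))                  ≈⟨ sym (⋁-map-F Δ) ⟩
    ⋁ (map h (map `F Δ))             ∎
  sound (PL {Γ} {Δ} {α} p) = begin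
    h (`P α) ∧ ⋀ (map h (map `H Γ))  ≈⟨ ∧-cong (h-P α) (⋀-map-H Γ) ⟩
    P (h α) ∧ H (⋀ (map h Γ))        ≤⟨ P-rule (sound p) ⟩
    P (⋁ (map h Δ))                  ≈⟨ sym (⋁-map-P Δ) ⟩
    ⋁ (map h (map `P Δ))             ∎
  sound (PGL {Δ} {α} p) = begin
    h (`P (`G α)) ∧ 1#  ≈⟨ ≈-trans (∧-identityʳ _) (≈-trans (h-P _) (P-cong (h-G α))) ⟩
    P (G (h α))         ≤⟨ ≤⇒⊑ (PG-counit _) ⟩
    h α                 ≈⟨ sym (∧-identityʳ _) ⟩
    h α ∧ 1#            ≤⟨ sound p ⟩
    ⋁ (map h Δ)         ∎
  sound (FHL {Δ} {α} p) = begin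
    h (`F (`H α)) ∧ 1#  ≈⟨ ≈-trans (∧-identityʳ _) (≈-trans (h-F _) (F-cong (h-H α))) ⟩
    F (H (h α))         ≤⟨ ≤⇒⊑ (FH-counit _) ⟩
    h α                 ≈⟨ sym (∧-identityʳ _) ⟩
    h α ∧ 1#            ≤⟨ sound p ⟩
    ⋁ (map h Δ)         ∎
  sound (GPR {Γ} {α} p) = begin
    ⋀ (map h Γ)         ≤⟨ sound p ⟩
    h α ∨ 0#            ≈⟨ ∨-identityʳ _ ⟩
    h α                 ≤⟨ ≤⇒⊑ (GP-unit _) ⟩
    G (P (h α))         ≈⟨ sym (≈-trans (h-G _) (G-cong (h-P α))) ⟩
    h (`G (`P α))       ≈⟨ sym (∨-identityʳ _) ⟩
    h (`G (`P α)) ∨ 0#  ∎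
  sound (HFR {Γ} {α} p) = begin
    ⋀ (map h Γ)         ≤⟨ sound p ⟩
    h α ∨ 0#            ≈⟨ ∨-identityʳ _ ⟩
    h α                 ≤⟨ ≤⇒⊑ (HF-unit _) ⟩
    H (F (h α))         ≈⟨ sym (≈-trans (h-H _) (H-cong (h-F α))) ⟩
    h (`H (`F α))       ≈⟨ sym (∨-identityʳ _) ⟩
    h (`H (`F α)) ∨ 0#  ∎

  ⇒-sound : ∀ {Γ Δ} → Γ ⇒ Δ → ⋀ (map h Γ) ≤ ⋁ (map h Δ)
  ⇒-sound = ⊑⇒≤ ∘ sound

-- Completeness

infix 4 _⊢_ _⊣⊢_

_⊢_ : Formula → Formula → Set
α ⊢ β = α ∷ [] ⇒ β ∷ []

_⊣⊢_ : Formula → Formula → Set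
α ⊣⊢ β = α ⊢ β × β ⊢ α

module Entailment where
  private variable α β γ : Formula

  ∧-lower₁ : α `∧ β ⊢ α
  ∧-lower₁ = ∧L (init #0 #0)

  ∧-lower₂ : α `∧ β ⊢ β
  ∧-lower₂ = ∧L (init #1 #0)

  ∨-upper₁ : α ⊢ α `∨ β
  ∨-upper₁ = ∨R (init #0 #0)

  ∨-upper₂ : β ⊢ α `∨ β
  ∨-upper₂ = ∨R (init #0 #1)

  ⊥-least : `⊥ ⊢ α
  ⊥-least = wR ⊥-ax

  ⊤-greatest : α ⊢ `⊤
  ⊤-greatest = wL ⊤-ax

  ⊢⇒∧⊣⊢ : α ⊢ β → α `∧ β ⊣⊢ α
  ⊢⇒∧⊣⊢ α⊢β = ∧-lower₁ , ∧R ax α⊢β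

  ∧-distribˡ-∨ : α `∧ (β `∨ γ) ⊣⊢ (α `∧ β) `∨ (α `∧ γ)
  ∧-distribˡ-∨ =
    ∧L (weaken swap⊆ id (∨L (∨R (∧R (init #1 #0) (init #0 #0)))
                            (∨R (weaken id swap⊆ (∧R (init #1 #0) (init #0 #0)))))) ,
    ∨L (∧L (∧R (init #0 #0) (∨R (init #1 #0)))) (∧L (∧R (init #0 #0) (∨R (init #1 #1))))

  G-mono : α ⊢ β → `G α ⊢ `G β
  G-mono = GR

  H-mono : α ⊢ β → `H α ⊢ `H β
  H-mono = HR

  F-mono : α ⊢ β → `F α ⊢ `F β
  F-mono = FL

  P-mono : α ⊢ β → `P α ⊢ `P β
  P-mono = PL

  G-⊤ : `G `⊤ ⊣⊢ `⊤
  G-⊤ = ⊤-greatest , wL (GR ⊤-ax)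

  H-⊤ : `H `⊤ ⊣⊢ `⊤
  H-⊤ = ⊤-greatest , wL (HR ⊤-ax)

  F-⊥ : `F `⊥ ⊣⊢ `⊥
  F-⊥ = wR (FL ⊥-ax) , ⊥-least

  P-⊥ : `P `⊥ ⊣⊢ `⊥
  P-⊥ = wR (PL ⊥-ax) , ⊥-least

  G-∧ : `G (α `∧ β) ⊣⊢ `G α `∧ `G β
  G-∧ = ∧R (G-mono ∧-lower₁) (G-mono ∧-lower₂) ,
        ∧L (GR {Δ = []} (∧R (init #0 #0) (init #1 #0)))

  H-∧ : `H (α `∧ β) ⊣⊢ `H α `∧ `H β
  H-∧ = ∧R (H-mono ∧-lower₁) (H-mono ∧-lower₂) ,
        ∧L (HR {Δ = []} (∧R (init #0 #0) (init #1 #0)))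

  F-∨ : `F (α `∨ β) ⊣⊢ `F α `∨ `F β
  F-∨ = ∨R (FL {Γ = []} (∨L (init #0 #0) (init #0 #1))) ,
        ∨L (F-mono ∨-upper₁) (F-mono ∨-upper₂)

  P-∨ : `P (α `∨ β) ⊣⊢ `P α `∨ `P β
  P-∨ = ∨R (PL {Γ = []} (∨L (init #0 #0) (init #0 #1))) ,
        ∨L (P-mono ∨-upper₁) (P-mono ∨-upper₂)

  G-∨ : `G (α `∨ β) ⊢ `G α `∨ `F β
  G-∨ = ∨R (GR (∨L (init #0 #0) (init #0 #1)))

  H-∨ : `H (α `∨ β) ⊢ `H α `∨ `P β
  H-∨ = ∨R (HR (∨L (init #0 #0) (init #0 #1)))

  G-F : `G α `∧ `F β ⊢ `F (α `∧ β)
  G-F = ∧L (weaken swap⊆ id (FL (∧R (init #1 #0) (init #0 #0))))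

  H-P : `H α `∧ `P β ⊢ `P (α `∧ β)
  H-P = ∧L (weaken swap⊆ id (PL (∧R (init #1 #0) (init #0 #0))))

module Lindenbaum (c ℓ : Level) where
  open Entailment

  Carrier : Set c
  Carrier = Lift c Formula

  _≈_ _⊑_ : Carrier → Carrier → Set ℓ
  x ≈ y = Lift ℓ (lower x ⊣⊢ lower y)
  x ⊑ y = Lift ℓ (lower x ⊢ lower y)

  _∧_ _∨_ : Carrier → Carrier → Carrier
  x ∧ y = lift (lower x `∧ lower y)
  x ∨ y = lift (lower x `∨ lower y)

  lifted : (Formula → Formula) → Carrier → Carrier
  lifted f = lift ∘ f ∘ lower

  orderLattice : Ord.DistributiveLattice c ℓ ℓ
  orderLattice = record
    { _≈_ = _≈_
    ; _≤_ = _⊑_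
    ; _∨_ = _∨_
    ; _∧_ = _∧_
    ; isDistributiveLattice = record
      { isLattice = record
        { isPartialOrder = record
          { isPreorder = record
            { isEquivalence = record
              { refl  = lift (ax , ax)
              ; sym   = λ (lift (p , q)) → lift (q , p)
              ; trans = λ (lift (p , q)) (lift (p′ , q′)) → lift (cut-single p p′ , cut-single q′ q)
              }
            ; reflexive = λ (lift (p , _)) → lift p
            ; trans     = λ (lift p) (lift q) → lift (cut-single p q)
            }
          ; antisym = λ (lift p) (lift q) → lift (p , q)
          }
        ; supremum = λ _ _ → lift ∨-upper₁ , lift ∨-upper₂ , λ _ (lift p) (lift q) → lift (∨L p q)
        ; infimum  = λ _ _ → lift ∧-lower₁ , lift ∧-lower₂ , λ _ (lift p) (lift q) → lift (∧R p q)
        }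
      ; ∧-distribˡ-∨ = λ _ _ _ → lift ∧-distribˡ-∨
      }
    }

  isDistributiveLattice : AlgStructures.IsDistributiveLattice _≈_ _∨_ _∧_
  isDistributiveLattice = record
    { isLattice   = OrdLatticeProperties.isAlgLattice (Ord.DistributiveLattice.lattice orderLattice)
    ; ∨-distrib-∧ = OrdDistributiveLatticeProperties.∨-distrib-∧ orderLattice
    ; ∧-distrib-∨ = OrdDistributiveLatticeProperties.∧-distrib-∨ orderLattice
    }

  algebra : TDLAlgebra c ℓ
  algebra = record
    { Carrier = Carrier
    ; _≈_ = _≈_
    ; _∧_ = _∧_
    ; _∨_ = _∨_
    ; 0# = lift `⊥
    ; 1# = lift `⊤
    ; G = lifted `G
    ; H = lifted `H
    ; F = lifted `F
    ; P = lifted `P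
    ; isDistributiveLattice = isDistributiveLattice
    ; ∨-identityʳ = λ _ → lift (∨L ax ⊥-least , ∨-upper₁)
    ; ∧-identityʳ = λ _ → lift (∧-lower₁ , ∧R ax ⊤-greatest)
    ; G-cong = λ (lift (p , q)) → lift (G-mono p , G-mono q)
    ; H-cong = λ (lift (p , q)) → lift (H-mono p , H-mono q)
    ; F-cong = λ (lift (p , q)) → lift (F-mono p , F-mono q)
    ; P-cong = λ (lift (p , q)) → lift (P-mono p , P-mono q)
    ; G-1 = lift G-⊤
    ; H-1 = lift H-⊤
    ; G-∧ = λ _ _ → lift G-∧
    ; H-∧ = λ _ _ → lift H-∧
    ; GP-unit = λ _ → lift (⊢⇒∧⊣⊢ (GPR ax))
    ; HF-unit = λ _ → lift (⊢⇒∧⊣⊢ (HFR ax))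
    ; G-∨ = λ _ _ → lift (⊢⇒∧⊣⊢ G-∨)
    ; H-∨ = λ _ _ → lift (⊢⇒∧⊣⊢ H-∨)
    ; F-0 = lift F-⊥
    ; P-0 = lift P-⊥
    ; F-∨ = λ _ _ → lift F-∨
    ; P-∨ = λ _ _ → lift P-∨
    ; PG-counit = λ _ → lift (⊢⇒∧⊣⊢ (PGL ax))
    ; FH-counit = λ _ → lift (⊢⇒∧⊣⊢ (FHL ax))
    ; G-F = λ _ _ → lift (⊢⇒∧⊣⊢ G-F)
    ; H-P = λ _ _ → lift (⊢⇒∧⊣⊢ H-P)
    }

  canonical : Hom algebra
  canonical = record
    { h   = lift
    ; h-⊤ = lift (ax , ax)
    ; h-⊥ = lift (ax , ax)
    ; h-∧ = λ _ _ → lift (ax , ax)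
    ; h-∨ = λ _ _ → lift (ax , ax)
    ; h-G = λ _ → lift (ax , ax)
    ; h-H = λ _ → lift (ax , ax)
    ; h-F = λ _ → lift (ax , ax)
    ; h-P = λ _ → lift (ax , ax)
    }

  open TDLAlgebra algebra using (⋀; ⋁)

  ⇒-⋀ : ∀ Γ → Γ ⇒ lower (⋀ (map lift Γ)) ∷ []
  ⇒-⋀ []      = ⊤-ax
  ⇒-⋀ (_ ∷ Γ) = ∧R (init #0 #0) (wL (⇒-⋀ Γ))

  ⋁-⇒ : ∀ Δ → lower (⋁ (map lift Δ)) ∷ [] ⇒ Δ
  ⋁-⇒ []      = ⊥-ax
  ⋁-⇒ (_ ∷ Δ) = ∨L (init #0 #0) (wR (⋁-⇒ Δ))

  complete : ∀ {Γ Δ} → Valid c ℓ Γ Δ → Γ ⇒ Δ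
  complete {Γ} {Δ} valid =
    cut-single (⇒-⋀ Γ) (cut-single (proj₂ (lower (valid algebra canonical))) (∧L (wL (⋁-⇒ Δ))))

corollary6p14 : ∀ {c ℓ : Level} (Γ Δ : Cedent) →
    ((Γ ⇒ Δ) ⇔ Valid c ℓ Γ Δ) × (Valid c ℓ Γ Δ ⇔ (Γ ⊨≤[ c , ℓ ] Δ))
corollary6p14 {c} {ℓ} Γ Δ =
  mk⇔ (λ p A φ → Soundness.⇒-sound A φ p) (Lindenbaum.complete c ℓ) , mk⇔ id id
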